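{- Let $G$ be a connected graph of order $n$ and $x$ a cut-vertex of $G$ such that $G-x$ has exactly two connected components $G_1,G_2$, of orders $n_1,n_2$. Suppose that for some $i\in\{1,2\}$ both $N(G'_i,x)\geq 2(n_i+1)$ and $a_i\leq 1/2$ hold. Then \[(n-1)N_1(x)N_2(x) > 2(n_2+1)N_1+2(n_1+1)N_2.\]
   Context: A set of vertices is a connected set if it induces a connected subgraph. $G'_i$ is the subgraph of $G$ induced by $V(G_i)\cup\{x\}$; $N_i=N(G_i)$ is the number of nonempty connected sets of $G_i$, and $N_i(x)=N(G'_i,x)$ is the number of connected sets of $G'_i$ containing $x$. $a_i=av(G'_i,x)/n_i$, where $av(F,x)$ for a connected graph $F$ with vertex $x$ is defined as follows: fix a shortest distance spanning tree $T$ of $F$ rooted at $x$ (tree paths to $x$ are shortest paths). Let $\mathcal C(F-x)$ be the nonempty connected sets of $F-x$ and $\mathcal C(F,x)$ the connected sets of $F$ containing $x$. For each $U\in\mathcal C(F-x)$ choose $v_U\in U$ closest to $x$, let $p_U$ be the vertex set of the path in $T$ from $v_U$ to $x$, with length $|p_U|$ (number of edges), and $\overline U=U\cup p_U$. For $Q\in\mathcal C(F,x)$ let $W(Q)=\{U\in\mathcal C(F-x):\overline U=Q\}$, ordered by $U\preceq U'$ iff $p_{U'}\subseteq p_U$, and when nonempty let $U_Q$ be its minimal element. Let $\mathcal M(F-x)=\{U_Q:W(Q)\neq\emptyset\}$ and $av(F,x)=\frac{1}{|\mathcal M(F-x)|}\sum_{U\in\mathcal M(F-x)}|p_U|$. 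-}

module Defs where

open import Data.Nat using (ℕ; zero; suc; _+_; _*_; _≤_)
open import Data.Fin using (Fin)
open import Data.Fin.Subset using (Subset; _∈_; _∉_; _⊆_; _∪_; ⁅_⁆; Nonempty; ∣_∣)
open import Data.List using (List; length; map)
open import Data.Nat.ListAction using (sum)
open import Data.List.Relation.Unary.Unique.Propositional using (Unique)
import Data.List.Membership.Propositional as LM
open import Data.Product using (Σ; ∃; _×_)
open import Data.Sum using (_⊎_)
open import Relation.Nullary using (¬_)
open import Relation.Binary.PropositionalEquality using (_≡_; _≢_)
open import Function.Bundles using (_⇔_)

record Graph (n : ℕ) : Set₁ where
  field
    E     : Fin n → Fin n → Set
    sym   : ∀ {u v} → E u v → E v u
    irrefl : ∀ {u} → ¬ E u u
open Graph public

module _ {n : ℕ} (G : Graph n) where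

  data WalkIn (S : Subset n) : Fin n → Fin n → ℕ → Set where
    here : ∀ {u} → u ∈ S → WalkIn S u u 0
    step : ∀ {u w v k} → u ∈ S → E G u w → WalkIn S w v k → WalkIn S u v (suc k)

  Connected : Subset n → Set
  Connected S = ∀ u v → u ∈ S → v ∈ S → ∃ λ k → WalkIn S u v k

  ConnSet : Subset n → Set
  ConnSet S = Nonempty S × Connected S

  DistIn : Subset n → Fin n → Fin n → ℕ → Set
  DistIn B v x d = WalkIn B v x d × (∀ k → WalkIn B v x k → d ≤ k)

IsCount : ∀ {n} → (Subset n → Set) → ℕ → Set
IsCount {n} P k = Σ (List (Subset n)) λ L →
  Unique L × (∀ S → (S LM.∈ L) ⇔ P S) × length L ≡ k

IsCountSum : ∀ {n} → (Subset n → Set) → (Subset n → ℕ) → ℕ → ℕ → Set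
IsCountSum {n} P f k s = Σ (List (Subset n)) λ L →
  Unique L × (∀ S → (S LM.∈ L) ⇔ P S) × length L ≡ k × sum (map f L) ≡ s

iter : ∀ {A : Set} → (A → A) → ℕ → A → A
iter f zero a = a
iter f (suc j) a = f (iter f j a)

record TwoComponents {n : ℕ} (G : Graph n) (x : Fin n) (V₁ V₂ : Subset n) : Set where
  field
    x∉V₁   : x ∉ V₁
    x∉V₂   : x ∉ V₂
    disj   : ∀ v → v ∈ V₁ → v ∉ V₂
    cover  : ∀ v → v ≢ x → v ∈ V₁ ⊎ v ∈ V₂
    conn₁  : ConnSet G V₁
    conn₂  : ConnSet G V₂
    noEdge : ∀ u v → u ∈ V₁ → v ∈ V₂ → ¬ E G u v

module _ {n : ℕ} (G : Graph n) (x : Fin n) (Vi : Subset n) where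

  -- vertex set of G'_i
  Bi : Subset n
  Bi = Vi ∪ ⁅ x ⁆

  CFx : Subset n → Set
  CFx U = ConnSet G U × U ⊆ Vi

  CFwith : Subset n → Set
  CFwith S = ConnSet G S × S ⊆ Bi × x ∈ S

  -- A shortest distance spanning tree T of G'_i rooted at x (given by its
  -- parent map 'par' and the depth/distance function 'd'), together with a
  -- choice U ↦ v_U of a vertex of U closest to x.
  record AvData : Set where
    field
      d        : Fin n → ℕ
      dist     : ∀ v → v ∈ Bi → DistIn G Bi v x (d v)
      par      : Fin n → Fin n
      par∈     : ∀ v → v ∈ Vi → par v ∈ Bi
      parE     : ∀ v → v ∈ Vi → E G v (par v)
      parD     : ∀ v → v ∈ Vi → suc (d (par v)) ≡ d v
      ch       : Subset n → Fin n
      ch∈      : ∀ U → CFx U → ch U ∈ U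
      chMin    : ∀ U → CFx U → ∀ w → w ∈ U → d (ch U) ≤ d w

    -- p_U : vertices of the T-path from v_U to x
    p : Subset n → Fin n → Set
    p U w = ∃ λ j → j ≤ d (ch U) × iter par j (ch U) ≡ w

    -- |p_U| (number of edges)
    len : Subset n → ℕ
    len U = d (ch U)

    bar : Subset n → Fin n → Set
    bar U w = w ∈ U ⊎ p U w

    -- U ∈ 𝓜(F - x): U is a minimal element of W(Ū) w.r.t. ⪯,
    -- where U' ⪯ U iff p_U ⊆ p_{U'}
    InM : Subset n → Set
    InM U = CFx U × (∀ U' → CFx U' → (∀ w → bar U' w ⇔ bar U w) →
              (∀ w → p U w → p U' w) → (∀ w → p U' w → p U w))

  -- a_i = av(G'_i, x) / n_i ≤ 1/2, computed w.r.t. the data A,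
  -- written as  2 · Σ_{U ∈ 𝓜} |p_U| ≤ n_i · |𝓜|
  AvLeHalf : Set
  AvLeHalf = Σ AvData λ A → ∃ λ m → ∃ λ s →
    IsCountSum (AvData.InM A) (AvData.len A) m s × 2 * s ≤ ∣ Vi ∣ * m

-- Fix a spanning tree of G′ⱼ rooted at x and let v_U be a vertex of U nearest to x.
-- Since Ū = U ∪ p_U and the path vertices other than v_U are closer to x than all of U,
-- U ↦ (Ū, v_U) is injective, so Nⱼ ≤ nⱼ Nⱼ(x); and v ↦ p_v gives nⱼ < Nⱼ(x).
-- On the side i with a_i ≤ 1/2, every U has a representative U₀ ∈ 𝓜 with Ū₀ = Ū and
-- v_U on p_{U₀}, so U ↦ (U₀, |p_U|) gives Nᵢ ≤ Σ_{U₀ ∈ 𝓜} |p_{U₀}| ≤ nᵢ |𝓜| / 2, while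
-- U ↦ Ū injects 𝓜 into the connected sets through x other than {x}, so |𝓜| < Nᵢ(x).
-- With Nᵢ(x) ≥ 2(nᵢ + 1) and n₁ + n₂ + 1 ≤ n the inequality follows by arithmetic.
module Submission where

open import Defs hiding (sym)
open import Algebra.Properties.CommutativeSemigroup using (xy∙z≈xz∙y)
open import Data.Bool using () renaming (_≟_ to _≟ᵇ_)
open import Data.Empty using (⊥-elim)
open import Data.Fin using (Fin)
import Data.Fin.Properties as Fin
open import Data.Fin.Subset
  using (Subset; ⊤; ∣_∣; _∈_; _∉_; _⊆_; _⊂_; _∪_; ⁅_⁆; Nonempty; inside; outside)
open import Data.Fin.Subset.Properties
  using (_∈?_; x∈p∪q⁺; x∈p∪q⁻; x∈⁅x⁆; x∈⁅y⁆⇒x≡y; ∈⊤; ⊆-antisym; ∣p∣≤n; ∣⁅x⁆∣≡1; p⊂q⇒∣p∣<∣q∣)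
open import Data.List using (List; []; _∷_; length; map; _++_; cartesianProduct; applyUpTo)
open import Data.List.Extrema.Nat using (argmin; argmin-sel; f[argmin]≤f[⊤]; f[argmin]≤f[xs])
open import Data.List.Membership.Propositional using (find; lose) renaming (_∈_ to _∈ₗ_)
open import Data.List.Membership.Propositional.Properties
  using (∈-++⁺ˡ; ∈-++⁺ʳ; ∈-length; ∈-map⁺; ∈-map⁻; ∈-applyUpTo⁺; ∈-cartesianProduct⁺)
open import Data.List.Properties using (length-++; length-map; length-removeAt′; length-applyUpTo)
import Data.List.Relation.Unary.All as All
open import Data.List.Relation.Unary.AllPairs using ([]; _∷_)
open import Data.List.Relation.Unary.Any using (Any; here; there; index; _─_; any?)
open import Data.List.Relation.Unary.Unique.Propositional using (Unique)
import Data.List.Relation.Unary.Unique.Propositional.Properties as Unique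
open import Data.Nat using (ℕ; zero; suc; _+_; _*_; _∸_; _≤_; _<_; z≤n; s≤s; >-nonZero)
open import Data.Nat.Induction using (<-rec)
open import Data.Nat.ListAction using (sum)
open import Data.Nat.Properties
open import Data.Nat.Tactic.RingSolver using (solve-∀)
open import Data.Product using (Σ; ∃; _×_; _,_; proj₁; proj₂)
open import Data.Sum using (_⊎_; inj₁; inj₂)
import Data.Sum as Sum
open import Data.Vec using ([]; _∷_; _[_]=_)
open _[_]=_
import Data.Vec.Properties as Vec
open import Data.Vec.Functional using (updateAt)
open import Data.Vec.Functional.Properties using (updateAt-updates; updateAt-minimal)
open import Function.Base using (_∘_; const)
open import Function.Bundles using (Equivalence; mk⇔; _⇔_)
open import Relation.Nullary using (Dec; yes; no)
open import Relation.Nullary.Decidable using (_×-dec_)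
open import Relation.Binary.PropositionalEquality

module _ {A : Set} where

  ∈-─⁺ : ∀ {xs : List A} {y z} (y∈xs : y ∈ₗ xs) → z ∈ₗ xs → z ≢ y → z ∈ₗ (xs ─ y∈xs)
  ∈-─⁺ (here refl) (here refl) z≢y = ⊥-elim (z≢y refl)
  ∈-─⁺ (here refl) (there z∈)  _   = z∈
  ∈-─⁺ (there y∈)  (here refl) _   = here refl
  ∈-─⁺ (there y∈)  (there z∈)  z≢y = there (∈-─⁺ y∈ z∈ z≢y)

InjectiveOn : {A B : Set} → (A → B) → List A → Set
InjectiveOn f xs = ∀ {a b} → a ∈ₗ xs → b ∈ₗ xs → f a ≡ f b → a ≡ b

module _ {A B : Set} {f : A → B} where

  length-≤-injection : ∀ {xs : List A} {ys : List B} → Unique xs → InjectiveOn f xs →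
                       (∀ {a} → a ∈ₗ xs → f a ∈ₗ ys) → length xs ≤ length ys
  length-≤-injection {[]}     _                 _   _    = z≤n
  length-≤-injection {a ∷ xs} {ys} (a∉xs ∷ uniq) inj maps = begin
    suc (length xs)             ≤⟨ s≤s (length-≤-injection uniq inj′ maps′) ⟩
    suc (length (ys ─ fa∈ys))   ≡⟨ length-removeAt′ ys (index fa∈ys) ⟨
    length ys                   ∎
    where
    open ≤-Reasoning
    fa∈ys = maps (here refl)
    inj′ : InjectiveOn f xs
    inj′ a∈ b∈ = inj (there a∈) (there b∈)
    maps′ : ∀ {b} → b ∈ₗ xs → f b ∈ₗ (ys ─ fa∈ys)
    maps′ b∈ = ∈-─⁺ fa∈ys (maps (there b∈))
      (λ fb≡fa → All.lookup a∉xs b∈ (inj (here refl) (there b∈) (sym fb≡fa)))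

  length-<-injection : ∀ {xs : List A} {ys : List B} {y} → Unique xs → InjectiveOn f xs →
                       (∀ {a} → a ∈ₗ xs → f a ∈ₗ ys) → y ∈ₗ ys → (∀ {a} → a ∈ₗ xs → f a ≢ y) →
                       length xs < length ys
  length-<-injection {xs} {ys} uniq inj maps y∈ys missed = begin-strict
    length xs                ≤⟨ length-≤-injection uniq inj (λ a∈ → ∈-─⁺ y∈ys (maps a∈) (missed a∈)) ⟩
    length (ys ─ y∈ys)       <⟨ n<1+n _ ⟩
    suc (length (ys ─ y∈ys)) ≡⟨ length-removeAt′ ys (index y∈ys) ⟨
    length ys                ∎
    where open ≤-Reasoning

module _ {A B : Set} where

  length-cartesianProduct : ∀ (xs : List A) (ys : List B) →
                            length (cartesianProduct xs ys) ≡ length xs * length ys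
  length-cartesianProduct []       ys = refl
  length-cartesianProduct (a ∷ xs) ys = begin
    length (map (a ,_) ys ++ cartesianProduct xs ys)          ≡⟨ length-++ (map (a ,_) ys) ⟩
    length (map (a ,_) ys) + length (cartesianProduct xs ys)  ≡⟨ cong₂ _+_ (length-map (a ,_) ys)
                                                                    (length-cartesianProduct xs ys) ⟩
    length ys + length xs * length ys                         ∎
    where open ≡-Reasoning

module _ {A : Set} where

  pairsUpTo : (A → ℕ) → List A → List (A × ℕ)
  pairsUpTo g []       = []
  pairsUpTo g (a ∷ xs) = map (a ,_) (applyUpTo suc (g a)) ++ pairsUpTo g xs

  length-pairsUpTo : ∀ g xs → length (pairsUpTo g xs) ≡ sum (map g xs)
  length-pairsUpTo g []       = refl
  length-pairsUpTo g (a ∷ xs) = begin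
    length (map (a ,_) js ++ pairsUpTo g xs)          ≡⟨ length-++ (map (a ,_) js) ⟩
    length (map (a ,_) js) + length (pairsUpTo g xs)  ≡⟨ cong₂ _+_ length-js (length-pairsUpTo g xs) ⟩
    g a + sum (map g xs)                              ∎
    where
    open ≡-Reasoning
    js = applyUpTo suc (g a)
    length-js = trans (length-map (a ,_) js) (length-applyUpTo suc (g a))

  ∈-pairsUpTo⁺ : ∀ {g xs a j} → a ∈ₗ xs → 0 < j → j ≤ g a → (a , j) ∈ₗ pairsUpTo g xs
  ∈-pairsUpTo⁺ {g} {a ∷ xs} {j = suc i} (here refl) _ i<ga =
    ∈-++⁺ˡ (∈-map⁺ (a ,_) (∈-applyUpTo⁺ suc i<ga))
  ∈-pairsUpTo⁺ {g} {b ∷ xs} (there a∈) 0<j j≤ga =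
    ∈-++⁺ʳ (map (b ,_) (applyUpTo suc (g b))) (∈-pairsUpTo⁺ a∈ 0<j j≤ga)

elements : ∀ {n} → Subset n → List (Fin n)
elements []            = []
elements (inside  ∷ p) = Fin.zero ∷ map Fin.suc (elements p)
elements (outside ∷ p) = map Fin.suc (elements p)

∈-elements⁺ : ∀ {n} (p : Subset n) {v} → v ∈ p → v ∈ₗ elements p
∈-elements⁺ (inside  ∷ p) here       = here refl
∈-elements⁺ (inside  ∷ p) (there v∈) = there (∈-map⁺ Fin.suc (∈-elements⁺ p v∈))
∈-elements⁺ (outside ∷ p) (there v∈) = ∈-map⁺ Fin.suc (∈-elements⁺ p v∈)

∈-elements⁻ : ∀ {n} (p : Subset n) {v} → v ∈ₗ elements p → v ∈ p
∈-elements⁻ (inside  ∷ p) (here refl) = here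
∈-elements⁻ (inside  ∷ p) (there v∈) with ∈-map⁻ Fin.suc v∈
... | w , w∈ , refl = there (∈-elements⁻ p w∈)
∈-elements⁻ (outside ∷ p) v∈ with ∈-map⁻ Fin.suc v∈
... | w , w∈ , refl = there (∈-elements⁻ p w∈)

length-elements : ∀ {n} (p : Subset n) → length (elements p) ≡ ∣ p ∣
length-elements []            = refl
length-elements (inside  ∷ p) = cong suc (trans (length-map Fin.suc (elements p)) (length-elements p))
length-elements (outside ∷ p) = trans (length-map Fin.suc (elements p)) (length-elements p)

elements-unique : ∀ {n} (p : Subset n) → Unique (elements p)
elements-unique []            = []
elements-unique (inside  ∷ p) = All.tabulate 0∉ ∷ Unique.map⁺ Fin.suc-injective (elements-unique p)
  where
  0∉ : ∀ {v} → v ∈ₗ map Fin.suc (elements p) → Fin.zero ≢ v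
  0∉ v∈ refl with ∈-map⁻ Fin.suc v∈
  ... | _ , _ , ()
elements-unique (outside ∷ p) = Unique.map⁺ Fin.suc-injective (elements-unique p)

nonempty⇒∣p∣>0 : ∀ {n} {p : Subset n} → Nonempty p → 0 < ∣ p ∣
nonempty⇒∣p∣>0 {p = p} (v , v∈p) = subst (0 <_) (length-elements p) (∈-length (∈-elements⁺ p v∈p))

∣p∪q∣≡∣p∣+∣q∣ : ∀ {n} (p q : Subset n) → (∀ v → v ∈ p → v ∉ q) → ∣ p ∪ q ∣ ≡ ∣ p ∣ + ∣ q ∣
∣p∪q∣≡∣p∣+∣q∣ []            []            _ = refl
∣p∪q∣≡∣p∣+∣q∣ (inside  ∷ p) (inside  ∷ q) disjoint = ⊥-elim (disjoint Fin.zero here here)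
∣p∪q∣≡∣p∣+∣q∣ (inside  ∷ p) (outside ∷ q) disjoint =
  cong suc (∣p∪q∣≡∣p∣+∣q∣ p q (λ v v∈p v∈q → disjoint (Fin.suc v) (there v∈p) (there v∈q)))
∣p∪q∣≡∣p∣+∣q∣ (outside ∷ p) (inside  ∷ q) disjoint =
  trans (cong suc (∣p∪q∣≡∣p∣+∣q∣ p q (λ v v∈p v∈q → disjoint (Fin.suc v) (there v∈p) (there v∈q))))
        (sym (+-suc ∣ p ∣ ∣ q ∣))
∣p∪q∣≡∣p∣+∣q∣ (outside ∷ p) (outside ∷ q) disjoint =
  ∣p∪q∣≡∣p∣+∣q∣ p q (λ v v∈p v∈q → disjoint (Fin.suc v) (there v∈p) (there v∈q))

module _ {A : Set} (f : A → A) where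

  iter-suc : ∀ j a → iter f j (f a) ≡ iter f (suc j) a
  iter-suc zero    a = refl
  iter-suc (suc j) a = cong f (iter-suc j a)

  iter-+ : ∀ j k a → iter f j (iter f k a) ≡ iter f (j + k) a
  iter-+ zero    k a = refl
  iter-+ (suc j) k a = cong f (iter-+ j k a)

module Walks {n : ℕ} (G : Graph n) where

  walk-start : ∀ {S u v k} → WalkIn G S u v k → u ∈ S
  walk-start (here u∈)     = u∈
  walk-start (step u∈ _ _) = u∈

  walk-length-0 : ∀ {S u v} → WalkIn G S u v 0 → u ≡ v
  walk-length-0 (here _) = refl

  walk-mono : ∀ {S S′ u v k} → S ⊆ S′ → WalkIn G S u v k → WalkIn G S′ u v k
  walk-mono S⊆S′ (here u∈)      = here (S⊆S′ u∈)
  walk-mono S⊆S′ (step u∈ e r)  = step (S⊆S′ u∈) e (walk-mono S⊆S′ r)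

  walk-++ : ∀ {S u v w k l} → WalkIn G S u v k → WalkIn G S v w l → WalkIn G S u w (k + l)
  walk-++ (here _)      r′ = r′
  walk-++ (step u∈ e r) r′ = step u∈ e (walk-++ r r′)

  walk-reverse : ∀ {S u v k} → WalkIn G S u v k → ∃ λ l → WalkIn G S v u l
  walk-reverse (here u∈)     = _ , here u∈
  walk-reverse (step u∈ e r) =
    _ , walk-++ (proj₂ (walk-reverse r)) (step (walk-start r) (Graph.sym G e) (here u∈))

  connected-via : ∀ {S} x → (∀ u → u ∈ S → ∃ λ k → WalkIn G S u x k) → Connected G S
  connected-via x walk u v u∈ v∈ =
    _ , walk-++ (proj₂ (walk u u∈)) (proj₂ (walk-reverse (proj₂ (walk v v∈))))

module _ {n : ℕ} (G : Graph n) (x : Fin n) (V : Subset n) where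

  V⊆Bi : V ⊆ Bi G x V
  V⊆Bi v∈ = x∈p∪q⁺ (inj₁ v∈)

  x∈Bi : x ∈ Bi G x V
  x∈Bi = x∈p∪q⁺ (inj₂ (x∈⁅x⁆ x))

  ∈Bi⁻ : ∀ {v} → v ∈ Bi G x V → v ∈ V ⊎ v ≡ x
  ∈Bi⁻ v∈ = Sum.map₂ (x∈⁅y⁆⇒x≡y x) (x∈p∪q⁻ V ⁅ x ⁆ v∈)

  -- A spanning tree of G′ᵢ rooted at x; unlike in av(G′ᵢ, x), depths need not be distances.
  record RootedTree : Set where
    field
      depth        : Fin n → ℕ
      parent       : Fin n → Fin n
      parent-∈     : ∀ v → v ∈ V → parent v ∈ Bi G x V
      parent-edge  : ∀ v → v ∈ V → E G v (parent v)
      depth-parent : ∀ v → v ∈ V → suc (depth (parent v)) ≡ depth v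
      depth-root   : depth x ≡ 0
      depth≡0⇒root : ∀ v → v ∈ Bi G x V → depth v ≡ 0 → v ≡ x

module Ancestry {n : ℕ} {G : Graph n} {x : Fin n} {V : Subset n} (T : RootedTree G x V) where
  open RootedTree T
  open Walks G

  private
    B = Bi G x V

  Ancestor : Fin n → Fin n → Set
  Ancestor v w = ∃ λ j → j ≤ depth v × iter parent j v ≡ w

  ancestorsUpTo : ℕ → Fin n → Subset n
  ancestorsUpTo zero    v = ⁅ v ⁆
  ancestorsUpTo (suc k) v = ⁅ v ⁆ ∪ ancestorsUpTo k (parent v)

  ancestors : Fin n → Subset n
  ancestors v = ancestorsUpTo (depth v) v

  ∈ancestorsUpTo⁺ : ∀ k v j → j ≤ k → iter parent j v ∈ ancestorsUpTo k v
  ∈ancestorsUpTo⁺ zero    v zero    _         = x∈⁅x⁆ v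
  ∈ancestorsUpTo⁺ (suc k) v zero    _         = x∈p∪q⁺ (inj₁ (x∈⁅x⁆ v))
  ∈ancestorsUpTo⁺ (suc k) v (suc j) (s≤s j≤k) =
    x∈p∪q⁺ (inj₂ (subst (_∈ ancestorsUpTo k (parent v)) (iter-suc parent j v)
                        (∈ancestorsUpTo⁺ k (parent v) j j≤k)))

  ∈ancestorsUpTo⁻ : ∀ k v {w} → w ∈ ancestorsUpTo k v → ∃ λ j → j ≤ k × iter parent j v ≡ w
  ∈ancestorsUpTo⁻ zero    v w∈ = 0 , z≤n , sym (x∈⁅y⁆⇒x≡y v w∈)
  ∈ancestorsUpTo⁻ (suc k) v w∈ with x∈p∪q⁻ ⁅ v ⁆ (ancestorsUpTo k (parent v)) w∈
  ... | inj₁ w∈⁅v⁆ = 0 , z≤n , sym (x∈⁅y⁆⇒x≡y v w∈⁅v⁆)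
  ... | inj₂ w∈rest with ∈ancestorsUpTo⁻ k (parent v) w∈rest
  ...   | j , j≤k , eq = suc j , s≤s j≤k , trans (sym (iter-suc parent j v)) eq

  ancestor⇒∈ancestors : ∀ {v w} → Ancestor v w → w ∈ ancestors v
  ancestor⇒∈ancestors (j , j≤ , refl) = ∈ancestorsUpTo⁺ _ _ j j≤

  ∈ancestors⇒ancestor : ∀ {v w} → w ∈ ancestors v → Ancestor v w
  ∈ancestors⇒ancestor = ∈ancestorsUpTo⁻ _ _

  iter-parent : ∀ {v} → v ∈ B → ∀ j → j ≤ depth v →
                iter parent j v ∈ B × depth (iter parent j v) + j ≡ depth v
  iter-parent {v} v∈ zero    _   = v∈ , +-identityʳ (depth v)
  iter-parent {v} v∈ (suc j) j<d with iter-parent v∈ j (<⇒≤ j<d)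
  ... | u∈ , eq with ∈Bi⁻ G x V u∈
  ...   | inj₁ u∈V = parent-∈ _ u∈V ,
                     trans (+-suc _ j) (trans (cong (_+ j) (depth-parent _ u∈V)) eq)
  ...   | inj₂ u≡x = ⊥-elim (<-irrefl refl (≤-trans j<d (≤-reflexive depth-v≡j)))
    where
    depth-v≡j : depth v ≡ j
    depth-v≡j = trans (sym eq) (cong (_+ j) (trans (cong depth u≡x) depth-root))

  ancestor-∈ : ∀ {v w} → v ∈ B → Ancestor v w → w ∈ B
  ancestor-∈ v∈ (j , j≤ , refl) = proj₁ (iter-parent v∈ j j≤)

  ancestor-depth-≤ : ∀ {v w} → v ∈ B → Ancestor v w → depth w ≤ depth v
  ancestor-depth-≤ v∈ (j , j≤ , refl) =
    subst (depth (iter parent j _) ≤_) (proj₂ (iter-parent v∈ j j≤)) (m≤m+n _ j)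

  ancestor-unique : ∀ {v w w′} → v ∈ B → Ancestor v w → Ancestor v w′ → depth w ≡ depth w′ → w ≡ w′
  ancestor-unique {v} v∈ (j , j≤ , refl) (j′ , j′≤ , refl) same-depth =
    cong (λ i → iter parent i v) (+-cancelˡ-≡ _ j j′ (begin
      depth (iter parent j v) + j    ≡⟨ proj₂ (iter-parent v∈ j j≤) ⟩
      depth v                        ≡⟨ proj₂ (iter-parent v∈ j′ j′≤) ⟨
      depth (iter parent j′ v) + j′  ≡⟨ cong (_+ j′) same-depth ⟨
      depth (iter parent j v) + j′   ∎))
    where open ≡-Reasoning

  ancestor-refl : ∀ v → Ancestor v v
  ancestor-refl v = 0 , z≤n , refl

  ancestor-trans : ∀ {u v w} → u ∈ B → Ancestor u v → Ancestor v w → Ancestor u w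
  ancestor-trans {u} u∈ (j , j≤ , refl) (j′ , j′≤ , refl) =
    j′ + j , subst (j′ + j ≤_) (proj₂ (iter-parent u∈ j j≤)) (+-monoˡ-≤ j j′≤) ,
    sym (iter-+ parent j′ j u)

  ancestor-root : ∀ {v} → v ∈ B → Ancestor v x
  ancestor-root {v} v∈ = depth v , ≤-refl ,
    depth≡0⇒root _ root∈ (+-cancelʳ-≡ (depth v) _ 0 (proj₂ (iter-parent v∈ (depth v) ≤-refl)))
    where root∈ = proj₁ (iter-parent v∈ (depth v) ≤-refl)

  ancestors-⊆ : ∀ {u v} → v ∈ B → u ∈ ancestors v → ancestors u ⊆ ancestors v
  ancestors-⊆ v∈ u∈ w∈ =
    ancestor⇒∈ancestors (ancestor-trans v∈ (∈ancestors⇒ancestor u∈) (∈ancestors⇒ancestor w∈))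

  walk-to-root : ∀ {v} → v ∈ B → WalkIn G (ancestors v) v x (depth v)
  walk-to-root v∈ = go _ _ v∈ refl
    where
    go : ∀ k v → v ∈ B → depth v ≡ k → WalkIn G (ancestorsUpTo k v) v x k
    go zero    v v∈ d≡0 = subst (λ w → WalkIn G ⁅ v ⁆ v w 0) (depth≡0⇒root v v∈ d≡0) (here (x∈⁅x⁆ v))
    go (suc k) v v∈ d≡k with ∈Bi⁻ G x V v∈
    ... | inj₂ refl = ⊥-elim (1+n≢0 (trans (sym d≡k) depth-root))
    ... | inj₁ v∈V  = step (x∈p∪q⁺ (inj₁ (x∈⁅x⁆ v))) (parent-edge v v∈V)
        (walk-mono (λ w∈ → x∈p∪q⁺ (inj₂ w∈))
          (go k (parent v) (parent-∈ v v∈V) (suc-injective (trans (depth-parent v v∈V) d≡k))))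

  ancestors-CFwith : ∀ {v} → v ∈ B → CFwith G x V (ancestors v)
  ancestors-CFwith {v} v∈ = ((x , x∈) , connected-via x walk) , ancestors⊆B , x∈
    where
    x∈ = ancestor⇒∈ancestors (ancestor-root v∈)
    ancestors⊆B : ancestors v ⊆ B
    ancestors⊆B w∈ = ancestor-∈ v∈ (∈ancestors⇒ancestor w∈)
    walk : ∀ u → u ∈ ancestors v → ∃ λ k → WalkIn G (ancestors v) u x k
    walk u u∈ = _ , walk-mono (ancestors-⊆ v∈ u∈) (walk-to-root (ancestors⊆B u∈))

  ancestors-root : ancestors x ≡ ⁅ x ⁆
  ancestors-root = cong (λ k → ancestorsUpTo k x) depth-root

  ⁅root⁆-CFwith : CFwith G x V ⁅ x ⁆
  ⁅root⁆-CFwith = subst (CFwith G x V) ancestors-root (ancestors-CFwith (x∈Bi G x V))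

  ancestors-injective : ∀ {u v} → u ∈ B → v ∈ B → ancestors u ≡ ancestors v → u ≡ v
  ancestors-injective {u} {v} u∈ v∈ eq =
    ancestor-unique v∈ u-below-v (ancestor-refl v)
      (≤-antisym (ancestor-depth-≤ v∈ u-below-v) (ancestor-depth-≤ u∈ v-below-u))
    where
    u-below-v = ∈ancestors⇒ancestor (subst (u ∈_) eq (ancestor⇒∈ancestors (ancestor-refl u)))
    v-below-u = ∈ancestors⇒ancestor (subst (v ∈_) (sym eq) (ancestor⇒∈ancestors (ancestor-refl v)))

∣V∣<count-CFwith : ∀ {n} {G : Graph n} {x V Nx} → x ∉ V → RootedTree G x V →
                   IsCount (CFwith G x V) Nx → ∣ V ∣ < Nx
∣V∣<count-CFwith {G = G} {x} {V} x∉V T (Ls , _ , spec , refl) =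
  subst (_< length Ls) (length-elements V)
    (length-<-injection (elements-unique V) injective maps ⁅x⁆∈Ls missed)
  where
  open Ancestry T
  ∈B : ∀ {v} → v ∈ₗ elements V → v ∈ Bi G x V
  ∈B v∈ = V⊆Bi G x V (∈-elements⁻ V v∈)
  injective : InjectiveOn ancestors (elements V)
  injective u∈ v∈ = ancestors-injective (∈B u∈) (∈B v∈)
  maps : ∀ {v} → v ∈ₗ elements V → ancestors v ∈ₗ Ls
  maps v∈ = Equivalence.from (spec _) (ancestors-CFwith (∈B v∈))
  ⁅x⁆∈Ls : ⁅ x ⁆ ∈ₗ Ls
  ⁅x⁆∈Ls = Equivalence.from (spec _) ⁅root⁆-CFwith
  missed : ∀ {v} → v ∈ₗ elements V → ancestors v ≢ ⁅ x ⁆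
  missed {v} v∈ eq = x∉V (subst (_∈ V) v≡x (∈-elements⁻ V v∈))
    where v≡x = x∈⁅y⁆⇒x≡y x (subst (v ∈_) eq (ancestor⇒∈ancestors (ancestor-refl v)))

record NearestChoice {n} {G : Graph n} {x V} (T : RootedTree G x V) : Set where
  open RootedTree T
  field
    nearest         : Subset n → Fin n
    nearest-∈       : ∀ U → CFx G x V U → nearest U ∈ U
    nearest-minimal : ∀ U → CFx G x V U → ∀ w → w ∈ U → depth (nearest U) ≤ depth w

module Closure {n} {G : Graph n} {x V} (x∉V : x ∉ V) {T : RootedTree G x V} (C : NearestChoice T) where
  open RootedTree T
  open NearestChoice C
  open Ancestry T
  open Walks G

  closure : Subset n → Subset n
  closure U = U ∪ ancestors (nearest U)

  nearest-∈V : ∀ {U} → CFx G x V U → nearest U ∈ V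
  nearest-∈V {U} U-cf = proj₂ U-cf (nearest-∈ U U-cf)

  nearest-∈B : ∀ {U} → CFx G x V U → nearest U ∈ Bi G x V
  nearest-∈B U-cf = V⊆Bi G x V (nearest-∈V U-cf)

  nearest≢root : ∀ {U} → CFx G x V U → nearest U ≢ x
  nearest≢root U-cf eq = x∉V (subst (_∈ V) eq (nearest-∈V U-cf))

  nearest-∈closure : ∀ U → CFx G x V U → nearest U ∈ closure U
  nearest-∈closure U U-cf = x∈p∪q⁺ (inj₁ (nearest-∈ U U-cf))

  closure-CFwith : ∀ {U} → CFx G x V U → CFwith G x V (closure U)
  closure-CFwith {U} U-cf@((_ , U-conn) , U⊆V) = ((x , x∈) , connected-via x walk) , closure⊆B , x∈
    where
    v = nearest U
    path-CF = ancestors-CFwith (nearest-∈B U-cf)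
    path-conn = proj₂ (proj₁ path-CF)
    path⊆B = proj₁ (proj₂ path-CF)
    x∈path = proj₂ (proj₂ path-CF)
    x∈ = x∈p∪q⁺ (inj₂ x∈path)
    walk : ∀ u → u ∈ closure U → ∃ λ k → WalkIn G (closure U) u x k
    walk u u∈ with x∈p∪q⁻ U (ancestors v) u∈
    ... | inj₁ u∈U = _ , walk-++ (walk-mono (λ w∈ → x∈p∪q⁺ (inj₁ w∈)) (proj₂ (U-conn u v u∈U (nearest-∈ U U-cf))))
                                 (walk-mono (λ w∈ → x∈p∪q⁺ (inj₂ w∈)) (walk-to-root (nearest-∈B U-cf)))
    ... | inj₂ u∈p = _ , walk-mono (λ w∈ → x∈p∪q⁺ (inj₂ w∈))
                                   (proj₂ (path-conn u x u∈p x∈path))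
    closure⊆B : closure U ⊆ Bi G x V
    closure⊆B u∈ with x∈p∪q⁻ U (ancestors v) u∈
    ... | inj₁ u∈U = V⊆Bi G x V (U⊆V u∈U)
    ... | inj₂ u∈p = path⊆B u∈p

  closure≢⁅x⁆ : ∀ {U} → CFx G x V U → closure U ≢ ⁅ x ⁆
  closure≢⁅x⁆ {U} U-cf eq =
    nearest≢root U-cf (x∈⁅y⁆⇒x≡y x (subst (nearest U ∈_) eq (nearest-∈closure U U-cf)))

  -- The path vertices other than v_U are strictly closer to x than all of U.
  closure-injective : ∀ {U U′} → CFx G x V U → CFx G x V U′ →
                      closure U ≡ closure U′ → depth (nearest U) ≡ depth (nearest U′) → U ≡ U′
  closure-injective U-cf U′-cf eq same-depth =
    ⊆-antisym (⊆-from-closure U-cf U′-cf eq same-depth) (⊆-from-closure U′-cf U-cf (sym eq) (sym same-depth))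
    where
    ⊆-from-closure : ∀ {U U′} → CFx G x V U → CFx G x V U′ →
                     closure U ≡ closure U′ → depth (nearest U) ≡ depth (nearest U′) → U ⊆ U′
    ⊆-from-closure {U} {U′} U-cf U′-cf eq same-depth {w} w∈U
      with x∈p∪q⁻ U′ (ancestors (nearest U′)) (subst (w ∈_) eq (x∈p∪q⁺ (inj₁ w∈U)))
    ... | inj₁ w∈U′ = w∈U′
    ... | inj₂ w∈p  = subst (_∈ U′) nearest≡w (nearest-∈ U′ U′-cf)
      where
      w-below = ∈ancestors⇒ancestor w∈p
      nearest≡w = ancestor-unique (nearest-∈B U′-cf) (ancestor-refl _) w-below
        (≤-antisym (subst (_≤ depth w) same-depth (nearest-minimal U U-cf w w∈U))
                   (ancestor-depth-≤ (nearest-∈B U′-cf) w-below))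

  count-CFx≤count-CFwith*∣V∣ : ∀ {N Nx} → IsCount (CFx G x V) N → IsCount (CFwith G x V) Nx →
                               N ≤ Nx * ∣ V ∣
  count-CFx≤count-CFwith*∣V∣ (Ls , uniq , spec , refl) (Lxs , _ , specx , refl) =
    subst (length Ls ≤_)
      (trans (length-cartesianProduct Lxs (elements V)) (cong (length Lxs *_) (length-elements V)))
      (length-≤-injection uniq injective maps)
    where
    cf : ∀ {U} → U ∈ₗ Ls → CFx G x V U
    cf U∈ = Equivalence.to (spec _) U∈
    injective : InjectiveOn (λ U → closure U , nearest U) Ls
    injective U∈ U′∈ eq = closure-injective (cf U∈) (cf U′∈) (cong proj₁ eq) (cong (depth ∘ proj₂) eq)
    maps : ∀ {U} → U ∈ₗ Ls → (closure U , nearest U) ∈ₗ cartesianProduct Lxs (elements V)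
    maps U∈ = ∈-cartesianProduct⁺ (Equivalence.from (specx _) (closure-CFwith (cf U∈)))
                                  (∈-elements⁺ V (nearest-∈V (cf U∈)))

nearestChoice : ∀ {n} {G : Graph n} {x V} (T : RootedTree G x V) → NearestChoice T
nearestChoice {n} {x = x} T = record
  { nearest         = nearest
  ; nearest-∈       = λ U ((v∈U , _) , _) → ∈-elements⁻ U (nearest-∈ₗ (∈-elements⁺ U (proj₂ v∈U)))
  ; nearest-minimal = λ U _ w w∈U → nearest-minimalₗ (∈-elements⁺ U w∈U)
  }
  where
  open RootedTree T
  argmin⁺ : List (Fin n) → Fin n
  argmin⁺ []       = x
  argmin⁺ (v ∷ vs) = argmin depth v vs
  nearest : Subset n → Fin n
  nearest U = argmin⁺ (elements U)
  nearest-∈ₗ : ∀ {vs v} → v ∈ₗ vs → argmin⁺ vs ∈ₗ vs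
  nearest-∈ₗ {v ∷ vs} _ = Sum.[ here , there ]′ (argmin-sel depth v vs)
  nearest-minimalₗ : ∀ {vs w} → w ∈ₗ vs → depth (argmin⁺ vs) ≤ depth w
  nearest-minimalₗ {v ∷ vs} (here refl) = f[argmin]≤f[⊤] {f = depth} v vs
  nearest-minimalₗ {v ∷ vs} (there w∈)  = All.lookup (f[argmin]≤f[xs] {f = depth} v vs) w∈

module SpanningTree {n : ℕ} (G : Graph n) (x : Fin n) (V : Subset n) (x∉V : x ∉ V) where

  private
    B = Bi G x V

  record PartialTree : Set where
    field
      S          : Subset n
      depth      : Fin n → ℕ
      parent     : Fin n → Fin n
      root∈      : x ∈ S
      S⊆B        : S ⊆ B
      depth-root : depth x ≡ 0
      parent-ok  : ∀ v → v ∈ S → v ≢ x → parent v ∈ S × E G v (parent v) × suc (depth (parent v)) ≡ depth v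
  open PartialTree

  singleton : PartialTree
  singleton = record
    { S = ⁅ x ⁆ ; depth = const 0 ; parent = λ v → v ; root∈ = x∈⁅x⁆ x
    ; S⊆B = λ v∈ → subst (_∈ B) (sym (x∈⁅y⁆⇒x≡y x v∈)) (x∈Bi G x V) ; depth-root = refl
    ; parent-ok = λ v v∈ v≢x → ⊥-elim (v≢x (x∈⁅y⁆⇒x≡y x v∈)) }

  Extends : PartialTree → PartialTree → Fin n → Set
  Extends t t′ u = S t ⊆ S t′ × u ∈ S t′

  module Graft (t : PartialTree) {u w} (u∉S : u ∉ S t) (u∈V : u ∈ V) (w∈S : w ∈ S t) (e : E G u w) where

    S′ = S t ∪ ⁅ u ⁆
    depth′ = updateAt (depth t) u (const (suc (depth t w)))
    parent′ = updateAt (parent t) u (const w)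

    ParentOk : Fin n → Set
    ParentOk v = parent′ v ∈ S′ × E G v (parent′ v) × suc (depth′ (parent′ v)) ≡ depth′ v

    ≢u : ∀ {v} → v ∈ S t → v ≢ u
    ≢u v∈S refl = u∉S v∈S

    depth′-old : ∀ {v} → v ∈ S t → depth′ v ≡ depth t v
    depth′-old v∈S = updateAt-minimal _ u (depth t) (≢u v∈S)

    parent′-old : ∀ {v} → v ∈ S t → parent′ v ≡ parent t v
    parent′-old v∈S = updateAt-minimal _ u (parent t) (≢u v∈S)

    parent′-new : parent′ u ≡ w
    parent′-new = updateAt-updates u (parent t)

    parent-ok-new : ParentOk u
    parent-ok-new =
      subst (_∈ S′) (sym parent′-new) (x∈p∪q⁺ (inj₁ w∈S)) ,
      subst (E G u) (sym parent′-new) e ,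
      (begin
        suc (depth′ (parent′ u)) ≡⟨ cong (suc ∘ depth′) parent′-new ⟩
        suc (depth′ w)           ≡⟨ cong suc (depth′-old w∈S) ⟩
        suc (depth t w)          ≡⟨ updateAt-updates u (depth t) ⟨
        depth′ u                 ∎)
      where open ≡-Reasoning

    parent-ok-old : ∀ {v} → v ∈ S t → v ≢ x → ParentOk v
    parent-ok-old {v} v∈S v≢x with parent-ok t v v∈S v≢x
    ... | p∈S , p-edge , p-depth =
      subst (_∈ S′) (sym (parent′-old v∈S)) (x∈p∪q⁺ (inj₁ p∈S)) ,
      subst (E G v) (sym (parent′-old v∈S)) p-edge ,
      (begin
        suc (depth′ (parent′ v))   ≡⟨ cong (suc ∘ depth′) (parent′-old v∈S) ⟩
        suc (depth′ (parent t v))  ≡⟨ cong suc (depth′-old p∈S) ⟩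
        suc (depth t (parent t v)) ≡⟨ p-depth ⟩
        depth t v                  ≡⟨ depth′-old v∈S ⟨
        depth′ v                   ∎)
      where open ≡-Reasoning

    parent-ok′ : ∀ v → v ∈ S′ → v ≢ x → ParentOk v
    parent-ok′ v v∈ v≢x with v Fin.≟ u | x∈p∪q⁻ (S t) ⁅ u ⁆ v∈
    ... | yes refl | _          = parent-ok-new
    ... | no v≢u   | inj₁ v∈S   = parent-ok-old v∈S v≢x
    ... | no v≢u   | inj₂ v∈⁅u⁆ = ⊥-elim (v≢u (x∈⁅y⁆⇒x≡y u v∈⁅u⁆))

    S′⊆B : S′ ⊆ B
    S′⊆B v∈ with x∈p∪q⁻ (S t) ⁅ u ⁆ v∈
    ... | inj₁ v∈S   = S⊆B t v∈S
    ... | inj₂ v∈⁅u⁆ = subst (_∈ B) (sym (x∈⁅y⁆⇒x≡y u v∈⁅u⁆)) (V⊆Bi G x V u∈V)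

    grafted : PartialTree
    grafted = record
      { S = S′ ; depth = depth′ ; parent = parent′ ; root∈ = x∈p∪q⁺ (inj₁ (root∈ t)) ; S⊆B = S′⊆B
      ; depth-root = trans (depth′-old (root∈ t)) (depth-root t) ; parent-ok = parent-ok′ }

  graft : ∀ t {u w} → u ∉ S t → u ∈ V → w ∈ S t → E G u w → Σ PartialTree λ t′ → Extends t t′ u
  graft t {u} u∉S u∈V w∈S e = grafted , (λ v∈ → x∈p∪q⁺ (inj₁ v∈)) , x∈p∪q⁺ (inj₂ (x∈⁅x⁆ u))
    where open Graft t u∉S u∈V w∈S e

  graftWalk : ∀ t {v k} → WalkIn G B v x k → Σ PartialTree λ t′ → Extends t t′ v
  graftWalk t (here _) = t , (λ v∈ → v∈) , root∈ t
  graftWalk t (step {u} {w} u∈B e walk) with graftWalk t walk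
  ... | t₁ , S⊆S₁ , w∈S₁ with u ∈? S t₁
  ...   | yes u∈S₁ = t₁ , S⊆S₁ , u∈S₁
  ...   | no u∉S₁ with ∈Bi⁻ G x V u∈B
  ...     | inj₂ refl = ⊥-elim (u∉S₁ (root∈ t₁))
  ...     | inj₁ u∈V with graft t₁ u∉S₁ u∈V w∈S₁ e
  ...       | t₂ , S₁⊆S₂ , u∈S₂ = t₂ , (λ v∈ → S₁⊆S₂ (S⊆S₁ v∈)) , u∈S₂

  module _ (reach : ∀ v → v ∈ V → ∃ λ k → WalkIn G B v x k) where

    graftAll : ∀ (vs : List (Fin n)) → (∀ {v} → v ∈ₗ vs → v ∈ V) →
               Σ PartialTree λ t → ∀ {v} → v ∈ₗ vs → v ∈ S t
    graftAll []       _    = singleton , λ ()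
    graftAll (v ∷ vs) vs⊆V with graftAll vs (vs⊆V ∘ there)
    ... | t₁ , vs⊆S₁ with graftWalk t₁ (proj₂ (reach v (vs⊆V (here refl))))
    ...   | t₂ , S₁⊆S₂ , v∈S₂ = t₂ , λ { (here refl) → v∈S₂ ; (there v∈) → S₁⊆S₂ (vs⊆S₁ v∈) }

    spanningTree : RootedTree G x V
    spanningTree = record
      { depth        = depth t
      ; parent       = parent t
      ; parent-∈     = λ v v∈V → S⊆B t (proj₁ (ok v∈V))
      ; parent-edge  = λ v v∈V → proj₁ (proj₂ (ok v∈V))
      ; depth-parent = λ v v∈V → proj₂ (proj₂ (ok v∈V))
      ; depth-root   = depth-root t
      ; depth≡0⇒root = depth≡0⇒root
      }
      where
      spanning = graftAll (elements V) (∈-elements⁻ V)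
      t = proj₁ spanning
      ok : ∀ {v} → v ∈ V → parent t v ∈ S t × E G v (parent t v) × suc (depth t (parent t v)) ≡ depth t v
      ok {v} v∈V = parent-ok t v (proj₂ spanning (∈-elements⁺ V v∈V)) (λ v≡x → x∉V (subst (_∈ V) v≡x v∈V))
      depth≡0⇒root : ∀ v → v ∈ B → depth t v ≡ 0 → v ≡ x
      depth≡0⇒root v v∈B d≡0 with ∈Bi⁻ G x V v∈B
      ... | inj₂ v≡x = v≡x
      ... | inj₁ v∈V = ⊥-elim (1+n≢0 (trans (proj₂ (proj₂ (ok v∈V))) d≡0))

module _ {n : ℕ} {G : Graph n} {x : Fin n} {V₁ V₂ : Subset n} where

  TwoComponents-swap : TwoComponents G x V₁ V₂ → TwoComponents G x V₂ V₁
  TwoComponents-swap tc = record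
    { x∉V₁   = x∉V₂
    ; x∉V₂   = x∉V₁
    ; disj   = λ v v∈V₂ v∈V₁ → disj v v∈V₁ v∈V₂
    ; cover  = λ v v≢x → Sum.swap (cover v v≢x)
    ; conn₁  = conn₂
    ; conn₂  = conn₁
    ; noEdge = λ u v u∈V₂ v∈V₁ e → noEdge v u v∈V₁ u∈V₂ (Graph.sym G e)
    }
    where open TwoComponents tc

  -- A walk from V₁ to x stays in V₁ until it first meets x, as no edge joins V₁ to V₂.
  component-walk : Connected G ⊤ → TwoComponents G x V₁ V₂ →
                   ∀ v → v ∈ V₁ → ∃ λ k → WalkIn G (Bi G x V₁) v x k
  component-walk conn tc v v∈V₁ = cut v∈V₁ (proj₂ (conn v x ∈⊤ ∈⊤))
    where
    open TwoComponents tc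
    cut : ∀ {u k} → u ∈ V₁ → WalkIn G ⊤ u x k → ∃ λ l → WalkIn G (Bi G x V₁) u x l
    cut u∈V₁ (here _) = ⊥-elim (x∉V₁ u∈V₁)
    cut u∈V₁ (step {w = w} _ e walk) with w Fin.≟ x
    ... | yes refl = _ , step (V⊆Bi G x V₁ u∈V₁) e (here (x∈Bi G x V₁))
    ... | no w≢x with cover w w≢x
    ...   | inj₁ w∈V₁ = _ , step (V⊆Bi G x V₁ u∈V₁) e (proj₂ (cut w∈V₁ walk))
    ...   | inj₂ w∈V₂ = ⊥-elim (noEdge _ w u∈V₁ w∈V₂ e)

  ∣V₁∣+∣V₂∣+1≤n : TwoComponents G x V₁ V₂ → ∣ V₁ ∣ + ∣ V₂ ∣ + 1 ≤ n
  ∣V₁∣+∣V₂∣+1≤n tc = begin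
    ∣ V₁ ∣ + ∣ V₂ ∣ + 1             ≡⟨ cong₂ _+_ (∣p∪q∣≡∣p∣+∣q∣ V₁ V₂ disj) (∣⁅x⁆∣≡1 x) ⟨
    ∣ V₁ ∪ V₂ ∣ + ∣ ⁅ x ⁆ ∣         ≡⟨ ∣p∪q∣≡∣p∣+∣q∣ (V₁ ∪ V₂) ⁅ x ⁆ x∉V₁∪V₂ ⟨
    ∣ (V₁ ∪ V₂) ∪ ⁅ x ⁆ ∣           ≤⟨ ∣p∣≤n ((V₁ ∪ V₂) ∪ ⁅ x ⁆) ⟩
    n                               ∎
    where
    open TwoComponents tc
    open ≤-Reasoning
    x∉V₁∪V₂ : ∀ v → v ∈ V₁ ∪ V₂ → v ∉ ⁅ x ⁆
    x∉V₁∪V₂ v v∈ v∈⁅x⁆ with x∈⁅y⁆⇒x≡y x v∈⁅x⁆ | x∈p∪q⁻ V₁ V₂ v∈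
    ... | refl | inj₁ x∈V₁ = x∉V₁ x∈V₁
    ... | refl | inj₂ x∈V₂ = x∉V₂ x∈V₂

  component-counts : Connected G ⊤ → TwoComponents G x V₁ V₂ → ∀ {N Nx} →
                     IsCount (CFx G x V₁) N → IsCount (CFwith G x V₁) Nx →
                     N ≤ Nx * ∣ V₁ ∣ × ∣ V₁ ∣ < Nx
  component-counts conn tc count countx =
    Closure.count-CFx≤count-CFwith*∣V∣ x∉V₁ (nearestChoice T) count countx ,
    ∣V∣<count-CFwith x∉V₁ T countx
    where
    open TwoComponents tc
    T = SpanningTree.spanningTree G x V₁ x∉V₁ (component-walk conn tc)

module _ {n : ℕ} {G : Graph n} {x : Fin n} {V : Subset n} where

  avTree : AvData G x V → RootedTree G x V
  avTree A = record
    { depth        = d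
    ; parent       = par
    ; parent-∈     = par∈
    ; parent-edge  = parE
    ; depth-parent = parD
    ; depth-root   = n≤0⇒n≡0 (proj₂ (dist x (x∈Bi G x V)) 0 (here (x∈Bi G x V)))
    ; depth≡0⇒root = λ v v∈ d≡0 → walk-length-0 (subst (WalkIn G (Bi G x V) v x) d≡0 (proj₁ (dist v v∈)))
    }
    where
    open AvData A
    open Walks G

  avNearest : (A : AvData G x V) → NearestChoice (avTree A)
  avNearest A = record { nearest = ch ; nearest-∈ = ch∈ ; nearest-minimal = chMin }
    where open AvData A

module MinimalSets {n : ℕ} {G : Graph n} {x : Fin n} {V : Subset n} (x∉V : x ∉ V) (A : AvData G x V)
                   {Ms : List (Subset n)} (Ms-spec : ∀ S → (S ∈ₗ Ms) ⇔ AvData.InM A S) where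
  open AvData A using (InM; bar; len)
  open RootedTree (avTree A) using (depth; depth≡0⇒root)
  open Ancestry (avTree A)
  open NearestChoice (avNearest A) using (nearest; nearest-∈; nearest-minimal)
  open Closure x∉V (avNearest A)

  ∈closure⇔bar : ∀ U w → w ∈ closure U ⇔ bar U w
  ∈closure⇔bar U w = mk⇔
    (λ w∈ → Sum.map₂ ∈ancestors⇒ancestor (x∈p∪q⁻ U (ancestors (nearest U)) w∈))
    (λ w∈ → x∈p∪q⁺ (Sum.map₂ ancestor⇒∈ancestors w∈))

  closure≡⇒bar⇔ : ∀ {U U′} → closure U′ ≡ closure U → ∀ w → bar U′ w ⇔ bar U w
  closure≡⇒bar⇔ {U} {U′} eq w = mk⇔
    (λ w∈ → Equivalence.to (∈closure⇔bar U w) (subst (w ∈_) eq (Equivalence.from (∈closure⇔bar U′ w) w∈)))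
    (λ w∈ → Equivalence.to (∈closure⇔bar U′ w) (subst (w ∈_) (sym eq) (Equivalence.from (∈closure⇔bar U w) w∈)))

  bar⇔⇒closure≡ : ∀ {U U′} → (∀ w → bar U′ w ⇔ bar U w) → closure U′ ≡ closure U
  bar⇔⇒closure≡ {U} {U′} same = ⊆-antisym
    (λ {w} w∈ → Equivalence.from (∈closure⇔bar U w) (Equivalence.to (same w) (Equivalence.to (∈closure⇔bar U′ w) w∈)))
    (λ {w} w∈ → Equivalence.from (∈closure⇔bar U′ w) (Equivalence.from (same w) (Equivalence.to (∈closure⇔bar U w) w∈)))

  -- If v_U lies on p_{U′}, then p_U ⊆ p_{U′}, and minimality of U gives equality.
  InM-depth : ∀ {U U′} → InM U → CFx G x V U′ → closure U ≡ closure U′ →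
              Ancestor (nearest U′) (nearest U) → depth (nearest U) ≡ depth (nearest U′)
  InM-depth {U} {U′} (U-cf , minimal) U′-cf eq v∈p′ =
    ≤-antisym (ancestor-depth-≤ (nearest-∈B U′-cf) v∈p′) (ancestor-depth-≤ (nearest-∈B U-cf) v′∈p)
    where
    v′∈p : Ancestor (nearest U) (nearest U′)
    v′∈p = minimal U′ U′-cf (closure≡⇒bar⇔ (sym eq)) (λ _ → ancestor-trans (nearest-∈B U′-cf) v∈p′)
                   (nearest U′) (ancestor-refl (nearest U′))

  InM-closure-injective : ∀ {U U′} → InM U → InM U′ → closure U ≡ closure U′ → U ≡ U′
  InM-closure-injective {U} {U′} U∈M@(U-cf , _) U′∈M@(U′-cf , _) eq =
    closure-injective U-cf U′-cf eq same-depth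
    where
    v∈Ū′ = subst (nearest U ∈_) eq (nearest-∈closure U U-cf)
    v′∈Ū = subst (nearest U′ ∈_) (sym eq) (nearest-∈closure U′ U′-cf)
    same-depth : depth (nearest U) ≡ depth (nearest U′)
    same-depth with x∈p∪q⁻ U′ (ancestors (nearest U′)) v∈Ū′ | x∈p∪q⁻ U (ancestors (nearest U)) v′∈Ū
    ... | inj₂ v∈p′ | _         = InM-depth U∈M U′-cf eq (∈ancestors⇒ancestor v∈p′)
    ... | inj₁ _    | inj₂ v′∈p = sym (InM-depth U′∈M U-cf (sym eq) (∈ancestors⇒ancestor v′∈p))
    ... | inj₁ v∈U′ | inj₁ v′∈U =
      ≤-antisym (nearest-minimal U U-cf _ v′∈U) (nearest-minimal U′ U′-cf _ v∈U′)

  Represents : Subset n → Subset n → Set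
  Represents U₀ U = closure U₀ ≡ closure U × nearest U ∈ ancestors (nearest U₀)

  represents? : ∀ U U₀ → Dec (Represents U₀ U)
  represents? U U₀ = Vec.≡-dec _≟ᵇ_ (closure U₀) (closure U) ×-dec (nearest U ∈? ancestors (nearest U₀))

  Represented : Subset n → Set
  Represented U = Any (λ U₀ → Represents U₀ U) Ms

  M⇒CFx : ∀ {U} → U ∈ₗ Ms → CFx G x V U
  M⇒CFx U∈ = proj₁ (Equivalence.to (Ms-spec _) U∈)

  represented-trans : ∀ {U U′} → closure U′ ≡ closure U → nearest U ∈ ancestors (nearest U′) →
                      Represented U′ → Represented U
  represented-trans eq v∈p′ r with find r
  ... | U₀ , U₀∈ , eq₀ , v′∈p₀ = lose U₀∈ (trans eq₀ eq , ancestors-⊆ (nearest-∈B (M⇒CFx U₀∈)) v′∈p₀ v∈p′)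

  -- Induction on n ∸ |p_U|: a witness U′ that U is not minimal has a strictly longer path.
  represented : ∀ U → CFx G x V U → Represented U
  represented U = <-rec Motive descend _ U refl
    where
    Motive : ℕ → Set
    Motive k = ∀ U → n ∸ ∣ ancestors (nearest U) ∣ ≡ k → CFx G x V U → Represented U
    descend : ∀ k → (∀ {j} → j < k → Motive j) → Motive k
    descend _ rec U refl U-cf with any? (represents? U) Ms
    ... | yes r  = r
    ... | no ¬r = ⊥-elim (¬r (lose (Equivalence.from (Ms-spec U) (U-cf , minimal)) self))
      where
      self : Represents U U
      self = refl , ancestor⇒∈ancestors (ancestor-refl (nearest U))
      minimal : ∀ U′ → CFx G x V U′ → (∀ w → bar U′ w ⇔ bar U w) →
                (∀ w → Ancestor (nearest U) w → Ancestor (nearest U′) w) →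
                ∀ w → Ancestor (nearest U′) w → Ancestor (nearest U) w
      minimal U′ U′-cf same p⊆p′ w w∈p′ with nearest U′ ∈? ancestors (nearest U)
      ... | yes v′∈p = ancestor-trans (nearest-∈B U-cf) (∈ancestors⇒ancestor v′∈p) w∈p′
      ... | no v′∉p  = ⊥-elim (¬r (represented-trans (bar⇔⇒closure≡ same) v∈p′ (rec shorter U′ refl U′-cf)))
        where
        v∈p′ = ancestor⇒∈ancestors (p⊆p′ _ (ancestor-refl (nearest U)))
        p⊂p′ : ancestors (nearest U) ⊂ ancestors (nearest U′)
        p⊂p′ = (λ w∈ → ancestor⇒∈ancestors (p⊆p′ _ (∈ancestors⇒ancestor w∈))) ,
               nearest U′ , ancestor⇒∈ancestors (ancestor-refl (nearest U′)) , v′∉p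
        shorter = ∸-monoʳ-< (p⊂q⇒∣p∣<∣q∣ p⊂p′) (∣p∣≤n (ancestors (nearest U′)))

  representative : Subset n → Subset n
  representative U with any? (represents? U) Ms
  ... | yes r = proj₁ (find r)
  ... | no _  = U

  representative-spec : ∀ {U} → CFx G x V U → representative U ∈ₗ Ms × Represents (representative U) U
  representative-spec {U} U-cf with any? (represents? U) Ms
  ... | yes r = proj₂ (find r)
  ... | no ¬r = ⊥-elim (¬r (represented U U-cf))

  count-CFx≤Σlen : ∀ {N} → IsCount (CFx G x V) N → N ≤ sum (map len Ms)
  count-CFx≤Σlen (Ls , uniq , spec , refl) =
    subst (length Ls ≤_) (length-pairsUpTo len Ms) (length-≤-injection uniq injective maps)
    where
    cf : ∀ {U} → U ∈ₗ Ls → CFx G x V U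
    cf U∈ = Equivalence.to (spec _) U∈
    f : Subset n → Subset n × ℕ
    f U = representative U , depth (nearest U)
    injective : InjectiveOn f Ls
    injective {U} {U′} U∈ U′∈ eq = closure-injective (cf U∈) (cf U′∈) same-closure (cong proj₂ eq)
      where
      same-closure = trans (sym (proj₁ (proj₂ (representative-spec (cf U∈)))))
                           (trans (cong (closure ∘ proj₁) eq) (proj₁ (proj₂ (representative-spec (cf U′∈)))))
    maps : ∀ {U} → U ∈ₗ Ls → f U ∈ₗ pairsUpTo len Ms
    maps {U} U∈ with representative-spec (cf U∈)
    ... | U₀∈ , _ , v∈p₀ = ∈-pairsUpTo⁺ U₀∈
      (n≢0⇒n>0 (λ d≡0 → nearest≢root (cf U∈) (depth≡0⇒root _ (nearest-∈B (cf U∈)) d≡0)))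
      (ancestor-depth-≤ (nearest-∈B (M⇒CFx U₀∈)) (∈ancestors⇒ancestor v∈p₀))

  count-M<count-CFwith : ∀ {Nx} → Unique Ms → IsCount (CFwith G x V) Nx → length Ms < Nx
  count-M<count-CFwith Ms-unique (Lxs , _ , specx , refl) =
    length-<-injection Ms-unique injective maps (Equivalence.from (specx _) ⁅root⁆-CFwith)
      (λ U∈ → closure≢⁅x⁆ (M⇒CFx U∈))
    where
    injective : InjectiveOn closure Ms
    injective U∈ U′∈ = InM-closure-injective (Equivalence.to (Ms-spec _) U∈) (Equivalence.to (Ms-spec _) U′∈)
    maps : ∀ {U} → U ∈ₗ Ms → closure U ∈ₗ Lxs
    maps U∈ = Equivalence.from (specx _) (closure-CFwith (M⇒CFx U∈))

-- m = |𝓜(G′ᵢ - x)| and s = Σ_{U ∈ 𝓜} |p_U|, so that s/m = av(G′ᵢ, x).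
counting-inequality : ∀ {n nᵢ nⱼ Nᵢ Nⱼ Nᵢx Nⱼx m s} →
                      0 < nᵢ → nᵢ + nⱼ + 1 ≤ n →
                      Nᵢ ≤ s → 2 * s ≤ nᵢ * m → m < Nᵢx → 2 * (nᵢ + 1) ≤ Nᵢx →
                      Nⱼ ≤ Nⱼx * nⱼ → nⱼ < Nⱼx →
                      2 * (nⱼ + 1) * Nᵢ + 2 * (nᵢ + 1) * Nⱼ < (n ∸ 1) * Nᵢx * Nⱼx
counting-inequality {n} {nᵢ} {nⱼ} {Nᵢ} {Nⱼ} {Nᵢx} {Nⱼx} {m} {s} nᵢ>0 order Nᵢ≤s average m<Nᵢx big Nⱼ≤ nⱼ<Nⱼx =
  begin-strict
    2 * (nⱼ + 1) * Nᵢ + 2 * (nᵢ + 1) * Nⱼ   <⟨ +-mono-<-≤ first second ⟩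
    Nⱼx * (nᵢ * Nᵢx) + Nᵢx * (Nⱼx * nⱼ)     ≡⟨ regroup nᵢ nⱼ Nᵢx Nⱼx ⟩
    (nᵢ + nⱼ) * Nᵢx * Nⱼx                   ≤⟨ *-monoˡ-≤ Nⱼx (*-monoˡ-≤ Nᵢx (m+n≤o⇒m≤o∸n (nᵢ + nⱼ) order)) ⟩
    (n ∸ 1) * Nᵢx * Nⱼx                     ∎
  where
  open ≤-Reasoning
  instance
    _ = >-nonZero nᵢ>0
    _ = >-nonZero (≤-<-trans z≤n nⱼ<Nⱼx)
  regroup : ∀ a b c d → d * (a * c) + c * (d * b) ≡ (a + b) * c * d
  regroup = solve-∀
  double : ∀ a b → 2 * (a + 1) * b ≡ (a + 1) * (2 * b)
  double = solve-∀
  first : 2 * (nⱼ + 1) * Nᵢ < Nⱼx * (nᵢ * Nᵢx)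
  first = begin-strict
    2 * (nⱼ + 1) * Nᵢ    ≡⟨ double nⱼ Nᵢ ⟩
    (nⱼ + 1) * (2 * Nᵢ)  ≤⟨ *-monoʳ-≤ (nⱼ + 1) (≤-trans (*-monoʳ-≤ 2 Nᵢ≤s) average) ⟩
    (nⱼ + 1) * (nᵢ * m)  ≤⟨ *-monoˡ-≤ (nᵢ * m) (subst (_≤ Nⱼx) (+-comm 1 nⱼ) nⱼ<Nⱼx) ⟩
    Nⱼx * (nᵢ * m)       <⟨ *-monoʳ-< Nⱼx (*-monoʳ-< nᵢ m<Nᵢx) ⟩
    Nⱼx * (nᵢ * Nᵢx)     ∎
  second : 2 * (nᵢ + 1) * Nⱼ ≤ Nᵢx * (Nⱼx * nⱼ)
  second = *-mono-≤ big Nⱼ≤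

module _ {n : ℕ} {G : Graph n} {x : Fin n} {V₁ V₂ : Subset n} where

  lemma6p4-first : Connected G ⊤ → TwoComponents G x V₁ V₂ → ∀ {N₁ N₂ N₁x N₂x} →
                   IsCount (CFx G x V₁) N₁ → IsCount (CFx G x V₂) N₂ →
                   IsCount (CFwith G x V₁) N₁x → IsCount (CFwith G x V₂) N₂x →
                   2 * (∣ V₁ ∣ + 1) ≤ N₁x → AvLeHalf G x V₁ →
                   2 * (∣ V₂ ∣ + 1) * N₁ + 2 * (∣ V₁ ∣ + 1) * N₂ < (n ∸ 1) * N₁x * N₂x
  lemma6p4-first conn tc count₁ count₂ count₁x count₂x big (A , _ , _ , (Ms , Ms-unique , Ms-spec , refl , refl) , average) =
    counting-inequality (nonempty⇒∣p∣>0 (proj₁ conn₁)) (∣V₁∣+∣V₂∣+1≤n tc)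
      (count-CFx≤Σlen count₁) average (count-M<count-CFwith Ms-unique count₁x) big
      (proj₁ counts₂) (proj₂ counts₂)
    where
    open TwoComponents tc
    open MinimalSets x∉V₁ A Ms-spec
    counts₂ = component-counts conn (TwoComponents-swap tc) count₂ count₂x

lemma6p4 : ∀ {n : ℕ} (G : Graph n) (x : Fin n) (V₁ V₂ : Subset n)
    → Connected G ⊤
    → TwoComponents G x V₁ V₂
    → ∀ (N₁ N₂ N₁x N₂x : ℕ)
    → IsCount (CFx G x V₁) N₁
    → IsCount (CFx G x V₂) N₂
    → IsCount (CFwith G x V₁) N₁x
    → IsCount (CFwith G x V₂) N₂x
    → (2 * (∣ V₁ ∣ + 1) ≤ N₁x × AvLeHalf G x V₁)
      ⊎ (2 * (∣ V₂ ∣ + 1) ≤ N₂x × AvLeHalf G x V₂)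
    → 2 * (∣ V₂ ∣ + 1) * N₁ + 2 * (∣ V₁ ∣ + 1) * N₂ < (n ∸ 1) * N₁x * N₂x
lemma6p4 G x V₁ V₂ conn tc N₁ N₂ N₁x N₂x count₁ count₂ count₁x count₂x (inj₁ (big , average)) =
  lemma6p4-first conn tc count₁ count₂ count₁x count₂x big average
lemma6p4 {n} G x V₁ V₂ conn tc N₁ N₂ N₁x N₂x count₁ count₂ count₁x count₂x (inj₂ (big , average)) =
  subst₂ _<_ (+-comm (2 * (∣ V₁ ∣ + 1) * N₂) _) (xy∙z≈xz∙y *-commutativeSemigroup (n ∸ 1) N₂x N₁x)
    (lemma6p4-first conn (TwoComponents-swap tc) count₂ count₁ count₂x count₁x big average)
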